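{- For every program $C$ of the while language and every predicate $Q$ on states, the access Hoare triple $\langle \mathrm{sp}_C(Q)\rangle\,C\,\langle Q\rangle$ is provable in access Hoare logic, where $\mathrm{sp}_C(Q) := \{ s : \exists s'\,( C:s\Rightarrow s' \wedge Q(s'))\}$.
   Context: States are mappings from variables to values; assertions are arbitrary predicates (sets) of states. Programs of the while language are built from $\mathtt{skip}$, assignments $V:=E$ ($V$ a variable, $E$ a side-effect-free expression possibly containing $V$), sequential composition $S;T$, $\mathtt{if}\ B\ \mathtt{then}\ S\ \mathtt{else}\ T$ and $\mathtt{while}\ B\ \mathtt{do}\ S$ ($B$ a boolean condition), with the standard deterministic big-step execution relation $C:s\Rightarrow s'$. Access Hoare logic is the calculus for triples $\langle P\rangle\,C\,\langle Q\rangle$ with the following axioms and rules: (skip) $\langle P\rangle\,\mathtt{skip}\,\langle P\rangle$; (assignment) $\langle P[E/V]\rangle\,V:=E\,\langle P\rangle$, where $P[E/V]$ replaces free occurrences of $V$ in $P$ by $E$; (consequence) from $P_2\rightarrow P_1$ (valid implication), $\langle P_2\rangle\,S\,\langle Q_2\rangle$ and $Q_1\rightarrow Q_2$ (valid implication) infer $\langle P_1\rangle\,S\,\langle Q_1\rangle$; (composition) from $\langle P\rangle\,S\,\langle R\rangle$ and $\langle R\rangle\,T\,\langle Q\rangle$ infer $\langle P\rangle\,S;T\,\langle Q\rangle$; (conditional) from $\langle B\rightarrow P\rangle\,S\,\langle Q\rangle$ and $\langle \neg B\rightarrow P\rangle\,T\,\langle Q\rangle$ infer $\langle P\rangle\,\mathtt{if}\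 B\ \mathtt{then}\ S\ \mathtt{else}\ T\,\langle Q\rangle$; (while) from $\langle B\rightarrow P\rangle\,S\,\langle P\rangle$ infer $\langle P\rangle\,\mathtt{while}\ B\ \mathtt{do}\ S\,\langle \neg B\rightarrow P\rangle$. -}

module Defs where

open import Data.Bool using (Bool; true; false) renaming (T to Holds)
open import Data.Product using (∃; _×_)
open import Relation.Nullary using (¬_; yes; no)
open import Relation.Binary.Definitions using (DecidableEquality)

module While (Var : Set) (_≟_ : DecidableEquality Var) (Val : Set) where

  State : Set
  State = Var → Val

  Expr : Set
  Expr = State → Val

  BExpr : Set
  BExpr = State → Bool

  Assn : Set₁
  Assn = State → Set

  update : State → Var → Val → State
  update s V v W with W ≟ V
  ... | yes _ = v
  ... | no  _ = s W

  data Cmd : Set where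
    skip   : Cmd
    _:=_   : Var → Expr → Cmd
    _︔_    : Cmd → Cmd → Cmd
    if_then_else_ : BExpr → Cmd → Cmd → Cmd
    WHILE_DO_ : BExpr → Cmd → Cmd

  data _∶_⇒_ : Cmd → State → State → Set where
    ⇒skip   : ∀ {s} → skip ∶ s ⇒ s
    ⇒assign : ∀ {s V E} → (V := E) ∶ s ⇒ update s V (E s)
    ⇒seq    : ∀ {S T s s' s''} → S ∶ s ⇒ s' → T ∶ s' ⇒ s'' → (S ︔ T) ∶ s ⇒ s''
    ⇒ifT    : ∀ {B S T s s'} → Holds (B s) → S ∶ s ⇒ s' → (if B then S else T) ∶ s ⇒ s'
    ⇒ifF    : ∀ {B S T s s'} → ¬ Holds (B s) → T ∶ s ⇒ s' → (if B then S else T) ∶ s ⇒ s'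
    ⇒whileT : ∀ {B S s s' s''} → Holds (B s) → S ∶ s ⇒ s' → (WHILE B DO S) ∶ s' ⇒ s''
              → (WHILE B DO S) ∶ s ⇒ s''
    ⇒whileF : ∀ {B S s} → ¬ Holds (B s) → (WHILE B DO S) ∶ s ⇒ s

  _[_/_] : Assn → Expr → Var → Assn
  (P [ E / V ]) s = P (update s V (E s))

  _⟹_ : BExpr → Assn → Assn
  (B ⟹ P) s = Holds (B s) → P s

  ¬ᵇ_⟹_ : BExpr → Assn → Assn
  (¬ᵇ B ⟹ P) s = ¬ Holds (B s) → P s

  _⊨→_ : Assn → Assn → Set
  P ⊨→ Q = ∀ s → P s → Q s

  data ⊢⟨_⟩_⟨_⟩ : Assn → Cmd → Assn → Set₁ where
    h-skip   : ∀ {P} → ⊢⟨ P ⟩ skip ⟨ P ⟩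
    h-assign : ∀ {P V E} → ⊢⟨ P [ E / V ] ⟩ (V := E) ⟨ P ⟩
    h-cons   : ∀ {P₁ P₂ Q₁ Q₂ S} → P₂ ⊨→ P₁ → ⊢⟨ P₂ ⟩ S ⟨ Q₂ ⟩ → Q₁ ⊨→ Q₂
               → ⊢⟨ P₁ ⟩ S ⟨ Q₁ ⟩
    h-seq    : ∀ {P R Q S T} → ⊢⟨ P ⟩ S ⟨ R ⟩ → ⊢⟨ R ⟩ T ⟨ Q ⟩ → ⊢⟨ P ⟩ (S ︔ T) ⟨ Q ⟩
    h-if     : ∀ {P Q B S T} → ⊢⟨ B ⟹ P ⟩ S ⟨ Q ⟩ → ⊢⟨ ¬ᵇ B ⟹ P ⟩ T ⟨ Q ⟩
               → ⊢⟨ P ⟩ (if B then S else T) ⟨ Q ⟩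
    h-while  : ∀ {P B S} → ⊢⟨ B ⟹ P ⟩ S ⟨ P ⟩ → ⊢⟨ P ⟩ (WHILE B DO S) ⟨ ¬ᵇ B ⟹ P ⟩

  sp : Cmd → Assn → Assn
  sp C Q s = ∃ λ s' → (C ∶ s ⇒ s') × Q s'

-- Induction on C, using sp of the remaining computation as the intermediate
-- assertion: for S ︔ T the midpoint is sp T Q, and for WHILE B DO S the
-- invariant is sp (WHILE B DO S) Q itself, which absorbs one more iteration of
-- the body when B holds and contains every state of Q where B fails.
module Submission where

open import Defs
open import Relation.Binary.Definitions using (DecidableEquality)
open import Data.Product using (_,_)

module SpTriple (Var : Set) (_≟_ : DecidableEquality Var) (Val : Set) where
  open While Var _≟_ Val

  weaken-pre : ∀ {P P′ S Q} → P ⊨→ P′ → ⊢⟨ P ⟩ S ⟨ Q ⟩ → ⊢⟨ P′ ⟩ S ⟨ Q ⟩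
  weaken-pre P⊨→P′ ⊢PSQ = h-cons P⊨→P′ ⊢PSQ (λ _ q → q)

  strengthen-post : ∀ {P S Q Q′} → Q′ ⊨→ Q → ⊢⟨ P ⟩ S ⟨ Q ⟩ → ⊢⟨ P ⟩ S ⟨ Q′ ⟩
  strengthen-post Q′⊨→Q ⊢PSQ = h-cons (λ _ p → p) ⊢PSQ Q′⊨→Q

  sp-skip : ∀ {Q} → Q ⊨→ sp skip Q
  sp-skip s q = s , ⇒skip , q

  sp-assign : ∀ {Q V E} → (Q [ E / V ]) ⊨→ sp (V := E) Q
  sp-assign s q = _ , ⇒assign , q

  sp-seq : ∀ {Q S T} → sp S (sp T Q) ⊨→ sp (S ︔ T) Q
  sp-seq s (s′ , S⇒ , s″ , T⇒ , q) = s″ , ⇒seq S⇒ T⇒ , q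

  sp-ifT : ∀ {Q B S T} → sp S Q ⊨→ (B ⟹ sp (if B then S else T) Q)
  sp-ifT s (s′ , S⇒ , q) b = s′ , ⇒ifT b S⇒ , q

  sp-ifF : ∀ {Q B S T} → sp T Q ⊨→ (¬ᵇ B ⟹ sp (if B then S else T) Q)
  sp-ifF s (s′ , T⇒ , q) ¬b = s′ , ⇒ifF ¬b T⇒ , q

  sp-whileT : ∀ {Q B S} → sp S (sp (WHILE B DO S) Q) ⊨→ (B ⟹ sp (WHILE B DO S) Q)
  sp-whileT s (s′ , S⇒ , s″ , W⇒ , q) b = s″ , ⇒whileT b S⇒ W⇒ , q

  sp-whileF : ∀ {Q B S} → Q ⊨→ (¬ᵇ B ⟹ sp (WHILE B DO S) Q)
  sp-whileF s q ¬b = s , ⇒whileF ¬b , q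

  ⊢sp : (C : Cmd) (Q : Assn) → ⊢⟨ sp C Q ⟩ C ⟨ Q ⟩
  ⊢sp skip Q = weaken-pre sp-skip h-skip
  ⊢sp (V := E) Q = weaken-pre sp-assign h-assign
  ⊢sp (S ︔ T) Q = weaken-pre sp-seq (h-seq (⊢sp S (sp T Q)) (⊢sp T Q))
  ⊢sp (if B then S else T) Q =
    h-if (weaken-pre sp-ifT (⊢sp S Q)) (weaken-pre sp-ifF (⊢sp T Q))
  ⊢sp (WHILE B DO S) Q =
    strengthen-post sp-whileF
      (h-while (weaken-pre sp-whileT (⊢sp S (sp (WHILE B DO S) Q))))

proposition6p3 : (Var : Set) (_≟_ : DecidableEquality Var) (Val : Set)
                 → let open While Var _≟_ Val in
                   (C : Cmd) (Q : Assn) → ⊢⟨ sp C Q ⟩ C ⟨ Q ⟩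
proposition6p3 = SpTriple.⊢sp
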